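{- Let $p$ be a prime. Every simplicial complex $C$ with $H_1(C,\mathbb F_p)=0$ that has no cut vertex is locally connected.
   Context: Simplicial complexes are finite and 2-dimensional; every vertex lies on an edge and every edge on a face. $H_1(C,\mathbb F_p)=0$ means every directed cycle of $C$ is generated over $\mathbb F_p$ by the boundaries of faces. A vertex $v$ of a connected complex is a cut vertex if the 1-skeleton with $v$ deleted is disconnected; in general, $v$ is a cut vertex if it is one in its connected component. The link graph $L(v)$ at $v$ has as vertices the edges at $v$ and as edges the faces at $v$ (a face joins its two edges containing $v$). $C$ is locally connected if all its link graphs are connected. -}

module Defs where

open import Data.Nat using (ℕ)
open import Data.Fin using (Fin)
open import Data.Fin.Properties using (_≟_)
open import Data.Integer using (ℤ; +_; _+_; _-_; _*_)
open import Data.Integer.Divisibility using (_∣_)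
open import Data.List using (List; []; _∷_; foldr; map; length; lookup; allFin)
open import Data.List.Relation.Unary.All using (All)
open import Data.List.Relation.Unary.Any using (Any)
open import Data.Product using (_×_; _,_; ∃; ∃-syntax)
open import Data.Sum using (_⊎_)
open import Relation.Nullary using (¬_; yes; no)
open import Relation.Binary.PropositionalEquality using (_≡_; _≢_)
open import Relation.Binary.Construct.Closure.ReflexiveTransitive using (Star)

-- A finite 2-dimensional simplicial complex on the vertex set Fin n is
-- given by its list of faces (triangles).  Edges are the 2-subsets of
-- faces (so every edge lies on a face); every vertex must lie on a face.
Triangle : ℕ → Set
Triangle n = Fin n × Fin n × Fin n

_∈▵_ : ∀ {n} → Fin n → Triangle n → Set
v ∈▵ (x , y , z) = v ≡ x ⊎ v ≡ y ⊎ v ≡ z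

WellFormed : (n : ℕ) → List (Triangle n) → Set
WellFormed n F =
  All (λ { (x , y , z) → x ≢ y × y ≢ z × x ≢ z }) F
  × ((v : Fin n) → Any (λ t → v ∈▵ t) F)

Edge : ∀ {n} → List (Triangle n) → Fin n → Fin n → Set
Edge F u v = u ≢ v × Any (λ t → u ∈▵ t × v ∈▵ t) F

_≡[mod_]_ : ℤ → ℕ → ℤ → Set
a ≡[mod p ] b = (+ p) ∣ (a - b)

Σℤ : ∀ {n} → (Fin n → ℤ) → ℤ
Σℤ {n} f = foldr (λ i acc → f i + acc) (+ 0) (allFin n)

-- A 1-chain is given by c : Fin n → Fin n → ℤ, standing for
-- Σ_{u,v} c u v · [u,v], where [u,v] = -[v,u] is the oriented edge.
Chain₁ : ℕ → Set
Chain₁ n = Fin n → Fin n → ℤ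

net : ∀ {n} → Chain₁ n → Fin n → Fin n → ℤ
net c u v = c u v - c v u

Supported : ∀ {n} → ℕ → List (Triangle n) → Chain₁ n → Set
Supported p F c = ∀ u v → ¬ (c u v ≡[mod p ] (+ 0)) → Edge F u v

∂₁ : ∀ {n} → Chain₁ n → Fin n → ℤ
∂₁ c w = Σℤ (λ u → c u w - c w u)

IsCycle : ∀ {n} → ℕ → Chain₁ n → Set
IsCycle p c = ∀ w → ∂₁ c w ≡[mod p ] (+ 0)

[_≟pair_] : ∀ {n} → (Fin n × Fin n) → (Fin n × Fin n) → ℤ
[ (a , b) ≟pair (u , v) ] with a ≟ u | b ≟ v
... | yes _ | yes _ = + 1
... | _     | _     = + 0

∂▵ : ∀ {n} → Triangle n → Chain₁ n
∂▵ (x , y , z) u v = [ (x , y) ≟pair (u , v) ] + [ (y , z) ≟pair (u , v) ] + [ (z , x) ≟pair (u , v) ]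

∂₂ : ∀ {n} (F : List (Triangle n)) → (Fin (length F) → ℤ) → Chain₁ n
∂₂ F a u v = Σℤ (λ i → a i * ∂▵ (lookup F i) u v)

H₁Vanishes : (p n : ℕ) → List (Triangle n) → Set
H₁Vanishes p n F =
  (c : Chain₁ n) → Supported p F c → IsCycle p c →
  ∃[ a ] (∀ u v → u ≢ v → net c u v ≡[mod p ] net (∂₂ F a) u v)

ConnectedAvoiding : ∀ {n} → List (Triangle n) → Fin n → Fin n → Fin n → Set
ConnectedAvoiding F v = Star (λ a b → Edge F a b × a ≢ v × b ≢ v)

Connected : ∀ {n} → List (Triangle n) → Fin n → Fin n → Set
Connected F = Star (Edge F)

IsCutVertex : ∀ {n} → List (Triangle n) → Fin n → Set
IsCutVertex F v = ∃[ u ] ∃[ w ]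
  (u ≢ v × w ≢ v × Connected F u w × ¬ ConnectedAvoiding F v u w)

-- vertices of L(v): (edges vu at v, identified with) vertices u with Edge v u;
-- edges of L(v): faces containing v, a face {v,a,b} joins vertices a and b.
LinkAdj : ∀ {n} → List (Triangle n) → Fin n → Fin n → Fin n → Set
LinkAdj F v a b = Any (λ t → v ∈▵ t × a ∈▵ t × b ∈▵ t) F × v ≢ a × v ≢ b × a ≢ b

LinkConnected : ∀ {n} → List (Triangle n) → Fin n → Set
LinkConnected F v = ∀ a b → Edge F v a → Edge F v b → Star (LinkAdj F v) a b

LocallyConnected : ∀ {n} → List (Triangle n) → Set
LocallyConnected F = ∀ v → LinkConnected F v

-- Suppose a and b are neighbours of v lying in different components of the link L(v), and let
-- K be the indicator of the component of a.  The 1-cochain φ with φ[v,x] = K x, vanishing on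
-- edges not at v, is a cocycle: on a face {v,y,z} it gives K y − K z = 0 since y, z are adjacent
-- in L(v).  Hence φ vanishes on boundaries.  If v is not a cut vertex, a and b are joined by a
-- path avoiding v; closing it up through v gives a cycle on which φ takes the value
-- K a − K b = 1.  As H₁(C, F_p) = 0 this cycle is a boundary mod p, so p ∣ 1.
module Submission where

open import Defs
open import Data.Bool using (if_then_else_)
open import Data.Nat as ℕ using (ℕ; zero; suc)
import Data.Nat.Properties as ℕ
open import Data.Nat.Primality using (Prime; ¬prime[1])
open import Data.Nat.Divisibility using (_∣0; ∣1⇒≡1)
open import Data.Integer.Divisibility using (_∣_)
open import Data.Fin using (Fin; zero; suc)
open import Data.Fin.Properties using (_≟_; any?)
open import Data.Integer using (ℤ; +_; _+_; _-_; _*_; -_)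
import Data.Integer.Properties as ℤ
open import Data.Integer.Divisibility.Signed as Signed using (divides; ∣ᵤ⇒∣; ∣⇒∣ᵤ; ∣n⇒∣m*n; ∣m∣n⇒∣m+n)
open import Data.Integer.Tactic.RingSolver using (solve-∀)
open import Algebra.Properties.Semiring.Sum ℤ.+-*-semiring
  using (sum; sum-cong-≗; sum-replicate-zero; ∑-distrib-+; ∑-comm; *-distribˡ-sum)
open import Data.List using (List; []; _∷_; foldr; length; lookup; tabulate; allFin; filter)
open import Data.List.Properties using (length-tabulate; filter-notAll)
open import Data.List.Membership.Propositional using (_∈_; lose)
open import Data.List.Membership.Propositional.Properties using (∈-filter⁺; ∈-allFin; ∈-lookup)
import Data.List.Relation.Unary.All as All
import Data.List.Relation.Unary.Any as Any
open import Data.Product using (_×_; _,_; ∃-syntax; proj₁; proj₂)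
open import Data.Sum using (_⊎_; inj₁; inj₂; reduce)
open import Data.Empty using (⊥-elim)
open import Function using (_∘_; id)
open import Relation.Binary using (Decidable)
open import Relation.Nullary using (¬_; Dec; does; yes; no; contradiction)
open import Relation.Nullary.Decidable using (dec-true; dec-false; map′; _×-dec_; _⊎-dec_; ¬?)
open import Relation.Binary.PropositionalEquality
open import Relation.Binary.Construct.Closure.ReflexiveTransitive
  using (Star; ε; _◅_; _◅◅_; return) renaming (map to mapStar)

open ≡-Reasoning

Σℤ≡sum : ∀ {n} (f : Fin n → ℤ) → Σℤ f ≡ sum f
Σℤ≡sum {n} f = foldr-tabulate id
  where
  foldr-tabulate : ∀ {m} (g : Fin m → Fin n) →
    foldr (λ i acc → f i + acc) (+ 0) (tabulate g) ≡ sum (f ∘ g)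
  foldr-tabulate {zero}  g = refl
  foldr-tabulate {suc m} g = cong (_+_ (f (g zero))) (foldr-tabulate (g ∘ suc))

∑-neg : ∀ {n} (f : Fin n → ℤ) → sum (λ i → - f i) ≡ - sum f
∑-neg {zero}  f = refl
∑-neg {suc n} f = trans (cong (_+_ (- f zero)) (∑-neg (f ∘ suc)))
                        (sym (ℤ.neg-distrib-+ (f zero) (sum (f ∘ suc))))

∑-distrib-− : ∀ {n} (f g : Fin n → ℤ) → sum (λ i → f i - g i) ≡ sum f - sum g
∑-distrib-− f g = trans (∑-distrib-+ f (λ i → - g i)) (cong (_+_ (sum f)) (∑-neg g))

∣-∑ : ∀ {n} {d : ℤ} (f : Fin n → ℤ) → (∀ i → d Signed.∣ f i) → d Signed.∣ sum f
∣-∑ {zero}  f _ = divides (+ 0) refl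
∣-∑ {suc n} f d∣f = ∣m∣n⇒∣m+n (d∣f zero) (∣-∑ (f ∘ suc) (d∣f ∘ suc))

𝟙[_] : ∀ {P : Set} → Dec P → ℤ
𝟙[ p? ] = if does p? then + 1 else + 0

𝟙-yes : ∀ {P : Set} (p? : Dec P) → P → 𝟙[ p? ] ≡ + 1
𝟙-yes p? p = cong (if_then + 1 else + 0) (dec-true p? p)

𝟙-no : ∀ {P : Set} (p? : Dec P) → ¬ P → 𝟙[ p? ] ≡ + 0
𝟙-no p? ¬p = cong (if_then + 1 else + 0) (dec-false p? ¬p)

𝟙-cong : ∀ {P Q : Set} (p? : Dec P) (q? : Dec Q) → (P → Q) → (Q → P) → 𝟙[ p? ] ≡ 𝟙[ q? ]
𝟙-cong p? q? P→Q Q→P with p?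
... | yes p = sym (𝟙-yes q? (P→Q p))
... | no ¬p = sym (𝟙-no q? (¬p ∘ Q→P))

δ : ∀ {n} → Fin n → Fin n → ℤ
δ x u = 𝟙[ x ≟ u ]

δ-refl : ∀ {n} (x : Fin n) → δ x x ≡ + 1
δ-refl x = 𝟙-yes (x ≟ x) refl

δ-≢ : ∀ {n} {x u : Fin n} → x ≢ u → δ x u ≡ + 0
δ-≢ {x = x} {u} = 𝟙-no (x ≟ u)

∑-δ : ∀ {n} (x : Fin n) (f : Fin n → ℤ) → sum (λ u → δ x u * f u) ≡ f x
∑-δ {suc n} zero    f = trans (cong₂ _+_ (ℤ.*-identityˡ (f zero)) (sum-replicate-zero n))
                              (ℤ.+-identityʳ (f zero))
∑-δ {suc n} (suc x) f = trans (ℤ.+-identityˡ _) (∑-δ x (f ∘ suc))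

module _ {n : ℕ} {R : Fin n → Fin n → Set} (R? : Decidable R) where

  WithinSteps : ℕ → Fin n → Fin n → Set
  WithinSteps zero    a b = a ≡ b
  WithinSteps (suc k) a b = a ≡ b ⊎ ∃[ x ] (R a x × WithinSteps k x b)

  withinSteps? : ∀ k → Decidable (WithinSteps k)
  withinSteps? zero    a b = a ≟ b
  withinSteps? (suc k) a b = a ≟ b ⊎-dec any? (λ x → R? a x ×-dec withinSteps? k x b)

  withinSteps⇒Star : ∀ k {a b} → WithinSteps k a b → Star R a b
  withinSteps⇒Star zero    refl               = ε
  withinSteps⇒Star (suc k) (inj₁ refl)        = ε
  withinSteps⇒Star (suc k) (inj₂ (_ , r , s)) = r ◅ withinSteps⇒Star k s

  Into : (Fin n → Set) → Fin n → Fin n → Set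
  Into P x y = R x y × P y

  fromLastVisit : ∀ {P : Fin n → Set} a {y b} → Star (Into P) y b →
    Star (Into (λ z → P z × z ≢ a)) y b ⊎ Star (Into (λ z → P z × z ≢ a)) a b
  fromLastVisit a ε = inj₁ ε
  fromLastVisit a (_◅_ {j = z} (r , pz) π) with fromLastVisit a π
  ... | inj₂ ρ = inj₂ ρ
  ... | inj₁ ρ with z ≟ a
  ...   | yes refl = inj₂ ρ
  ...   | no z≢a   = inj₁ ((r , pz , z≢a) ◅ ρ)

  -- Cutting a walk after its last visit to a, the rest avoids a, so it lives in a shorter list.
  shorten : ∀ k (L : List (Fin n)) {a b} → length L ℕ.≤ k → a ∈ L →
    Star (Into (_∈ L)) a b → WithinSteps k a b
  shorten zero    []      _  ()  _
  shorten zero    (_ ∷ _) () _   _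
  shorten (suc k) L {a} |L|≤1+k a∈L π with reduce (fromLastVisit a π)
  ... | ε = inj₁ refl
  ... | (r , y∈L , y≢a) ◅ ρ =
    inj₂ (_ , r , shorten k L′ |L′|≤k (keep y∈L y≢a)
                           (mapStar (λ (r , z∈L , z≢a) → r , keep z∈L z≢a) ρ))
    where
    L′ : List (Fin n)
    L′ = filter (λ z → ¬? (z ≟ a)) L
    keep : ∀ {z} → z ∈ L → z ≢ a → z ∈ L′
    keep = ∈-filter⁺ (λ z → ¬? (z ≟ a))
    |L′|<|L| : length L′ ℕ.< length L
    |L′|<|L| = filter-notAll (λ z → ¬? (z ≟ a)) L (Any.map (λ a≡z z≢a → z≢a (sym a≡z)) a∈L)
    |L′|≤k : length L′ ℕ.≤ k
    |L′|≤k = ℕ.≤-pred (ℕ.≤-trans |L′|<|L| |L|≤1+k)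

  star? : Decidable (Star R)
  star? a b = map′ (withinSteps⇒Star n) fromStar (withinSteps? n a b)
    where
    fromStar : Star R a b → WithinSteps n a b
    fromStar π = shorten n (allFin n) (ℕ.≤-reflexive (length-tabulate id)) (∈-allFin a)
                   (mapStar (λ r → r , ∈-allFin _) π)

⟦_,_⟧ : ∀ {n} → Fin n → Fin n → Chain₁ n
⟦ x , y ⟧ u w = [ (x , y) ≟pair (u , w) ]

⟦,⟧≡δ*δ : ∀ {n} (x y u w : Fin n) → ⟦ x , y ⟧ u w ≡ δ x u * δ y w
⟦,⟧≡δ*δ x y u w with x ≟ u | y ≟ w
... | yes _ | yes _ = refl
... | yes _ | no _  = refl
... | no _  | yes _ = refl
... | no _  | no _  = refl

_⊕_ : ∀ {n} → Chain₁ n → Chain₁ n → Chain₁ n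
(c ⊕ d) u w = c u w + d u w

walkChain : ∀ {n} {R : Fin n → Fin n → Set} {a b} → Star R a b → Chain₁ n
walkChain ε                          = λ _ _ → + 0
walkChain (_◅_ {i = x} {j = y} _ π) = ⟦ x , y ⟧ ⊕ walkChain π

SupportedOnEdges : ∀ {n} → List (Triangle n) → Chain₁ n → Set
SupportedOnEdges F c = ∀ u w → c u w ≡ + 0 ⊎ Edge F u w

module _ {n : ℕ} {F : List (Triangle n)} where

  ⟦,⟧-supported : ∀ {x y} → Edge F x y → SupportedOnEdges F ⟦ x , y ⟧
  ⟦,⟧-supported {x} {y} xy u w with x ≟ u | y ≟ w
  ... | yes refl | yes refl = inj₂ xy
  ... | yes _    | no _     = inj₁ refl
  ... | no _     | yes _    = inj₁ refl
  ... | no _     | no _     = inj₁ refl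

  ⊕-supported : ∀ {c d} → SupportedOnEdges F c → SupportedOnEdges F d → SupportedOnEdges F (c ⊕ d)
  ⊕-supported sc sd u w with sc u w | sd u w
  ... | inj₂ uw   | _         = inj₂ uw
  ... | inj₁ _    | inj₂ uw   = inj₂ uw
  ... | inj₁ c≡0  | inj₁ d≡0  = inj₁ (cong₂ _+_ c≡0 d≡0)

  walkChain-supported : ∀ {R : Fin n → Fin n → Set} → (∀ {x y} → R x y → Edge F x y) →
    ∀ {a b} (π : Star R a b) → SupportedOnEdges F (walkChain π)
  walkChain-supported R⇒E ε       = λ _ _ → inj₁ refl
  walkChain-supported R⇒E (r ◅ π) = ⊕-supported (⟦,⟧-supported (R⇒E r)) (walkChain-supported R⇒E π)

  supported : ∀ {p c} → SupportedOnEdges F c → Supported p F c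
  supported {p} sc u w c≢0 with sc u w
  ... | inj₁ c≡0 rewrite c≡0 = contradiction (p ∣0) c≢0
  ... | inj₂ uw  = uw

-- φ d pairs the chain d with the 1-cochain that takes the value K x on [v,x] and vanishes
-- on edges not at v.

module StarCochain {n : ℕ} (v : Fin n) (K : Fin n → ℤ) where

  φ : Chain₁ n → ℤ
  φ d = sum (λ x → K x * net d v x)

  φ-⊕ : ∀ c d → φ (c ⊕ d) ≡ φ c + φ d
  φ-⊕ c d = trans (sum-cong-≗ λ x → expand (K x) (c v x) (d v x) (c x v) (d x v))
                  (∑-distrib-+ (λ x → K x * net c v x) (λ x → K x * net d v x))
    where
    expand : ∀ k a b a′ b′ → k * ((a + b) - (a′ + b′)) ≡ k * (a - a′) + k * (b - b′)
    expand = solve-∀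

  φ-scale : ∀ k d → φ (λ u w → k * d u w) ≡ k * φ d
  φ-scale k d = trans (sum-cong-≗ λ x → commute (K x) k (d v x) (d x v))
                      (sym (*-distribˡ-sum k (λ x → K x * net d v x)))
    where
    commute : ∀ κ k a a′ → κ * (k * a - k * a′) ≡ k * (κ * (a - a′))
    commute = solve-∀

  φ-Σℤ : ∀ {m} (g : Fin m → Chain₁ n) → φ (λ u w → Σℤ (λ i → g i u w)) ≡ sum (λ i → φ (g i))
  φ-Σℤ g = begin
    sum (λ x → K x * (Σℤ (λ i → g i v x) - Σℤ (λ i → g i x v)))
      ≡⟨ sum-cong-≗ (λ x → cong (K x *_) (net-Σℤ x)) ⟩
    sum (λ x → K x * sum (λ i → net (g i) v x))
      ≡⟨ sum-cong-≗ (λ x → *-distribˡ-sum (K x) (λ i → net (g i) v x)) ⟩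
    sum (λ x → sum (λ i → K x * net (g i) v x))
      ≡⟨ ∑-comm (λ x i → K x * net (g i) v x) ⟩
    sum (λ i → φ (g i)) ∎
    where
    net-Σℤ : ∀ x → Σℤ (λ i → g i v x) - Σℤ (λ i → g i x v) ≡ sum (λ i → net (g i) v x)
    net-Σℤ x = begin
      Σℤ (λ i → g i v x) - Σℤ (λ i → g i x v)   ≡⟨ cong₂ _-_ (Σℤ≡sum (λ i → g i v x)) (Σℤ≡sum (λ i → g i x v)) ⟩
      sum (λ i → g i v x) - sum (λ i → g i x v) ≡⟨ ∑-distrib-− (λ i → g i v x) (λ i → g i x v) ⟨
      sum (λ i → net (g i) v x)                 ∎

  φ-∂₂ : (F : List (Triangle n)) (α : Fin (length F) → ℤ) →
    (∀ i → φ (∂▵ (lookup F i)) ≡ + 0) → φ (∂₂ F α) ≡ + 0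
  φ-∂₂ F α φ∂▵≡0 = begin
    φ (∂₂ F α)                                        ≡⟨ φ-Σℤ (λ i u w → α i * ∂▵ (lookup F i) u w) ⟩
    sum (λ i → φ (λ u w → α i * ∂▵ (lookup F i) u w))
      ≡⟨ trans (sum-cong-≗ term≡0) (sum-replicate-zero (length F)) ⟩
    + 0                                               ∎
    where
    term≡0 : ∀ i → φ (λ u w → α i * ∂▵ (lookup F i) u w) ≡ + 0
    term≡0 i = trans (φ-scale (α i) (∂▵ (lookup F i)))
                     (trans (cong (α i *_) (φ∂▵≡0 i)) (ℤ.*-zeroʳ (α i)))

  φ-⟦,⟧ : ∀ x y → φ ⟦ x , y ⟧ ≡ δ x v * K y - δ y v * K x
  φ-⟦,⟧ x y = begin
    sum (λ w → K w * (⟦ x , y ⟧ v w - ⟦ x , y ⟧ w v))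
      ≡⟨ sum-cong-≗ (λ w → trans (cong (K w *_) (cong₂ _-_ (⟦,⟧≡δ*δ x y v w) (⟦,⟧≡δ*δ x y w v)))
                                 (regroup (K w) (δ x v) (δ y w) (δ x w) (δ y v))) ⟩
    sum (λ w → δ y w * (δ x v * K w) - δ x w * (δ y v * K w))
      ≡⟨ ∑-distrib-− (λ w → δ y w * (δ x v * K w)) (λ w → δ x w * (δ y v * K w)) ⟩
    sum (λ w → δ y w * (δ x v * K w)) - sum (λ w → δ x w * (δ y v * K w))
      ≡⟨ cong₂ _-_ (∑-δ y _) (∑-δ x _) ⟩
    δ x v * K y - δ y v * K x ∎
    where
    regroup : ∀ k a b c d → k * (a * b - c * d) ≡ b * (a * k) - c * (d * k)
    regroup = solve-∀

  φ-∂▵ : ∀ {x y z} → (x ≡ v → K y ≡ K z) → (y ≡ v → K z ≡ K x) → (z ≡ v → K x ≡ K y) →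
    φ (∂▵ (x , y , z)) ≡ + 0
  φ-∂▵ {x} {y} {z} hx hy hz = begin
    φ ((⟦ x , y ⟧ ⊕ ⟦ y , z ⟧) ⊕ ⟦ z , x ⟧)
      ≡⟨ trans (φ-⊕ (⟦ x , y ⟧ ⊕ ⟦ y , z ⟧) ⟦ z , x ⟧)
               (cong (_+ φ ⟦ z , x ⟧) (φ-⊕ ⟦ x , y ⟧ ⟦ y , z ⟧)) ⟩
    φ ⟦ x , y ⟧ + φ ⟦ y , z ⟧ + φ ⟦ z , x ⟧
      ≡⟨ cong₂ _+_ (cong₂ _+_ (φ-⟦,⟧ x y) (φ-⟦,⟧ y z)) (φ-⟦,⟧ z x) ⟩
    (δ x v * K y - δ y v * K x) + (δ y v * K z - δ z v * K y) + (δ z v * K x - δ x v * K z)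
      ≡⟨ regroup (δ x v) (δ y v) (δ z v) (K x) (K y) (K z) ⟩
    δ x v * (K y - K z) + δ y v * (K z - K x) + δ z v * (K x - K y)
      ≡⟨ cong₂ _+_ (cong₂ _+_ (corner hx) (corner hy)) (corner hz) ⟩
    + 0 ∎
    where
    regroup : ∀ a b c A B C → (a * B - b * A) + (b * C - c * B) + (c * A - a * C)
                            ≡ a * (B - C) + b * (C - A) + c * (A - B)
    regroup = solve-∀
    corner : ∀ {t u w} → (t ≡ v → K u ≡ K w) → δ t v * (K u - K w) ≡ + 0
    corner {t} {u} {w} h with t ≟ v
    ... | yes refl = trans (ℤ.*-identityˡ _) (ℤ.i≡j⇒i-j≡0 (h refl))
    ... | no _     = refl

  φ-face : (F : List (Triangle n)) → WellFormed n F →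
    (∀ {y z} → LinkAdj F v y z → K y ≡ K z) → ∀ t → t ∈ F → φ (∂▵ t) ≡ + 0
  φ-face F wf K-adj (x , y , z) t∈F with All.lookup (proj₁ wf) t∈F
  ... | x≢y , y≢z , x≢z = φ-∂▵ {x} {y} {z}
    (λ { refl → K-adj (lose t∈F (inj₁ refl , inj₂ (inj₁ refl) , inj₂ (inj₂ refl)) ,
                        x≢y , x≢z , y≢z) })
    (λ { refl → K-adj (lose t∈F (inj₂ (inj₁ refl) , inj₂ (inj₂ refl) , inj₁ refl) ,
                        y≢z , x≢y ∘ sym , x≢z ∘ sym) })
    (λ { refl → K-adj (lose t∈F (inj₂ (inj₂ refl) , inj₁ refl , inj₂ (inj₁ refl)) ,
                        x≢z ∘ sym , y≢z ∘ sym , x≢y) })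

  φ-walkChain-avoiding : ∀ {R : Fin n → Fin n → Set} {a b}
    (π : Star (λ x y → R x y × x ≢ v × y ≢ v) a b) → φ (walkChain π) ≡ + 0
  φ-walkChain-avoiding ε = trans (sum-cong-≗ (λ x → ℤ.*-zeroʳ (K x))) (sum-replicate-zero n)
  φ-walkChain-avoiding (_◅_ {i = x} {j = y} (_ , x≢v , y≢v) π) =
    trans (φ-⊕ ⟦ x , y ⟧ (walkChain π))
          (cong₂ _+_ (trans (φ-⟦,⟧ x y) (cong₂ (λ s t → s * K y - t * K x) (δ-≢ x≢v) (δ-≢ y≢v)))
                     (φ-walkChain-avoiding π))

  φ-cong-mod : ∀ {p} c d → (∀ x → v ≢ x → net c v x ≡[mod p ] net d v x) → φ c ≡[mod p ] φ d
  φ-cong-mod {p} c d c≡d = ∣⇒∣ᵤ (subst (+ p Signed.∣_) φc-φd (∣-∑ _ term))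
    where
    φc-φd : sum (λ x → K x * (net c v x - net d v x)) ≡ φ c - φ d
    φc-φd = trans (sum-cong-≗ λ x → distrib (K x) (net c v x) (net d v x))
                  (∑-distrib-− (λ x → K x * net c v x) (λ x → K x * net d v x))
      where
      distrib : ∀ k a b → k * (a - b) ≡ k * a - k * b
      distrib = solve-∀
    term : ∀ x → + p Signed.∣ K x * (net c v x - net d v x)
    term x with v ≟ x
    ... | no v≢x   = ∣n⇒∣m*n (K x) (∣ᵤ⇒∣ (c≡d x v≢x))
    ... | yes refl =
      subst (λ e → + p Signed.∣ K x * e) (sym net≡0) (divides (+ 0) (ℤ.*-zeroʳ (K x)))
      where
      net≡0 : net c x x - net d x x ≡ + 0
      net≡0 = cong₂ _-_ (ℤ.+-inverseʳ (c x x)) (ℤ.+-inverseʳ (d x x))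

∂₁≡-φ : ∀ {n} (c : Chain₁ n) w → ∂₁ c w ≡ - StarCochain.φ w (λ _ → + 1) c
∂₁≡-φ c w = begin
  Σℤ (λ u → c u w - c w u)               ≡⟨ Σℤ≡sum (λ u → c u w - c w u) ⟩
  sum (λ u → c u w - c w u)              ≡⟨ sum-cong-≗ (λ u → flip (c u w) (c w u)) ⟩
  sum (λ u → - (+ 1 * (c w u - c u w)))  ≡⟨ ∑-neg (λ u → + 1 * (c w u - c u w)) ⟩
  - StarCochain.φ w (λ _ → + 1) c        ∎
  where
  flip : ∀ a b → a - b ≡ - (+ 1 * (b - a))
  flip = solve-∀

∂₁-⊕ : ∀ {n} (c d : Chain₁ n) w → ∂₁ (c ⊕ d) w ≡ ∂₁ c w + ∂₁ d w
∂₁-⊕ c d w = begin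
  ∂₁ (c ⊕ d) w    ≡⟨ ∂₁≡-φ (c ⊕ d) w ⟩
  - φ (c ⊕ d)     ≡⟨ cong -_ (φ-⊕ c d) ⟩
  - (φ c + φ d)   ≡⟨ ℤ.neg-distrib-+ (φ c) (φ d) ⟩
  - φ c + - φ d   ≡⟨ cong₂ _+_ (∂₁≡-φ c w) (∂₁≡-φ d w) ⟨
  ∂₁ c w + ∂₁ d w ∎
  where open StarCochain w (λ _ → + 1)

∂₁-⟦,⟧ : ∀ {n} (x y w : Fin n) → ∂₁ ⟦ x , y ⟧ w ≡ δ y w - δ x w
∂₁-⟦,⟧ x y w = trans (∂₁≡-φ ⟦ x , y ⟧ w) (trans (cong -_ (φ-⟦,⟧ x y)) (flip (δ x w) (δ y w)))
  where
  open StarCochain w (λ _ → + 1)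
  flip : ∀ a b → - (a * + 1 - b * + 1) ≡ b - a
  flip = solve-∀

∂₁-walkChain : ∀ {n} {R : Fin n → Fin n → Set} {a b} (π : Star R a b) w →
  ∂₁ (walkChain π) w ≡ δ b w - δ a w
∂₁-walkChain {n} {a = a} ε w =
  trans (trans (Σℤ≡sum {n} (λ _ → + 0)) (sum-replicate-zero n)) (sym (ℤ.+-inverseʳ (δ a w)))
∂₁-walkChain {a = x} {b} (_◅_ {j = y} _ π) w = begin
  ∂₁ (⟦ x , y ⟧ ⊕ walkChain π) w           ≡⟨ ∂₁-⊕ ⟦ x , y ⟧ (walkChain π) w ⟩
  ∂₁ ⟦ x , y ⟧ w + ∂₁ (walkChain π) w      ≡⟨ cong₂ _+_ (∂₁-⟦,⟧ x y w) (∂₁-walkChain π w) ⟩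
  (δ y w - δ x w) + (δ b w - δ y w)        ≡⟨ telescope (δ x w) (δ y w) (δ b w) ⟩
  δ b w - δ x w                            ∎
  where
  telescope : ∀ p q r → (q - p) + (r - q) ≡ r - p
  telescope = solve-∀

∈▵? : ∀ {n} (v : Fin n) (t : Triangle n) → Dec (v ∈▵ t)
∈▵? v (x , y , z) = v ≟ x ⊎-dec v ≟ y ⊎-dec v ≟ z

linkAdj? : ∀ {n} (F : List (Triangle n)) v → Decidable (LinkAdj F v)
linkAdj? F v a b = Any.any? (λ t → ∈▵? v t ×-dec ∈▵? a t ×-dec ∈▵? b t) F
  ×-dec ¬? (v ≟ a) ×-dec ¬? (v ≟ b) ×-dec ¬? (a ≟ b)

LinkAdj-sym : ∀ {n} {F : List (Triangle n)} {v a b} → LinkAdj F v a b → LinkAdj F v b a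
LinkAdj-sym (t , v≢a , v≢b , a≢b) = Any.map (λ (v∈t , a∈t , b∈t) → v∈t , b∈t , a∈t) t , v≢b , v≢a , a≢b ∘ sym

Edge-sym : ∀ {n} {F : List (Triangle n)} {a b} → Edge F a b → Edge F b a
Edge-sym (a≢b , t) = a≢b ∘ sym , Any.map (λ (a∈t , b∈t) → b∈t , a∈t) t

module _ {n : ℕ} {F : List (Triangle n)} {v a b : Fin n}
         (va : Edge F v a) (vb : Edge F v b) (π : ConnectedAvoiding F v a b) where

  detour : Chain₁ n
  detour = (⟦ v , a ⟧ ⊕ walkChain π) ⊕ ⟦ b , v ⟧

  detour-supported : SupportedOnEdges F detour
  detour-supported = ⊕-supported (⊕-supported (⟦,⟧-supported va) (walkChain-supported proj₁ π))
                                 (⟦,⟧-supported (Edge-sym vb))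

  detour-closed : ∀ w → ∂₁ detour w ≡ + 0
  detour-closed w = begin
    ∂₁ detour w
      ≡⟨ trans (∂₁-⊕ (⟦ v , a ⟧ ⊕ walkChain π) ⟦ b , v ⟧ w)
               (cong (_+ ∂₁ ⟦ b , v ⟧ w) (∂₁-⊕ ⟦ v , a ⟧ (walkChain π) w)) ⟩
    ∂₁ ⟦ v , a ⟧ w + ∂₁ (walkChain π) w + ∂₁ ⟦ b , v ⟧ w
      ≡⟨ cong₂ _+_ (cong₂ _+_ (∂₁-⟦,⟧ v a w) (∂₁-walkChain π w)) (∂₁-⟦,⟧ b v w) ⟩
    (δ a w - δ v w) + (δ b w - δ a w) + (δ v w - δ b w)
      ≡⟨ cancel (δ a w) (δ b w) (δ v w) ⟩
    + 0 ∎
    where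
    cancel : ∀ A B V → (A - V) + (B - A) + (V - B) ≡ + 0
    cancel = solve-∀

  φ-detour : (K : Fin n → ℤ) → StarCochain.φ v K detour ≡ K a - K b
  φ-detour K = begin
    φ detour
      ≡⟨ trans (φ-⊕ (⟦ v , a ⟧ ⊕ walkChain π) ⟦ b , v ⟧)
               (cong (_+ φ ⟦ b , v ⟧) (φ-⊕ ⟦ v , a ⟧ (walkChain π))) ⟩
    φ ⟦ v , a ⟧ + φ (walkChain π) + φ ⟦ b , v ⟧
      ≡⟨ cong₂ _+_ (cong₂ _+_ (φ-⟦,⟧ v a) (φ-walkChain-avoiding π)) (φ-⟦,⟧ b v) ⟩
    (δ v v * K a - δ a v * K v) + + 0 + (δ b v * K v - δ v v * K b)
      ≡⟨ evaluate (δ-refl v) (δ-≢ (proj₁ va ∘ sym)) (δ-≢ (proj₁ vb ∘ sym)) ⟩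
    K a - K b ∎
    where
    open StarCochain v K
    evaluate : δ v v ≡ + 1 → δ a v ≡ + 0 → δ b v ≡ + 0 →
      (δ v v * K a - δ a v * K v) + + 0 + (δ b v * K v - δ v v * K b) ≡ K a - K b
    evaluate vv av bv rewrite vv | av | bv = simplify (K a) (K b) (K v)
      where
      simplify : ∀ A B V → (+ 1 * A - + 0 * V) + + 0 + (+ 0 * V - + 1 * B) ≡ A - B
      simplify = solve-∀

  detour-cycle : ∀ {p} → IsCycle p detour
  detour-cycle {p} w = subst (λ e → e ≡[mod p ] (+ 0)) (sym (detour-closed w)) (p ∣0)

  link-invariant-mod : ∀ {p} → WellFormed n F → H₁Vanishes p n F → (K : Fin n → ℤ) →
    (∀ {y z} → LinkAdj F v y z → K y ≡ K z) → K a ≡[mod p ] K b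
  link-invariant-mod {p} wf H K K-adj = subst (+ p ∣_) (ℤ.+-identityʳ (K a - K b)) Ka-Kb≡0
    where
    open StarCochain v K
    boundary : ∃[ α ] (∀ u w → u ≢ w → net detour u w ≡[mod p ] net (∂₂ F α) u w)
    boundary = H detour (supported detour-supported) detour-cycle
    α : Fin (length F) → ℤ
    α = proj₁ boundary
    Ka-Kb≡0 : (K a - K b) ≡[mod p ] (+ 0)
    Ka-Kb≡0 = subst₂ _≡[mod p ]_ (φ-detour K) (φ-∂₂ F α (λ i → φ-face F wf K-adj (lookup F i) (∈-lookup i)))
                (φ-cong-mod detour (∂₂ F α) (proj₂ boundary v))

link-connected : ∀ {p n} {F : List (Triangle n)} → Prime p → WellFormed n F → H₁Vanishes p n F →
  ∀ v → ¬ IsCutVertex F v → LinkConnected F v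
link-connected {p} {F = F} p-prime wf H v ¬cut a b va vb with star? (linkAdj? F v) a b
... | yes a⇝b = a⇝b
... | no a⇸b = ⊥-elim (¬cut (a , b , proj₁ va ∘ sym , proj₁ vb ∘ sym , Edge-sym va ◅ vb ◅ ε , ¬avoiding))
  where
  reach? : ∀ x → Dec (Star (LinkAdj F v) a x)
  reach? = star? (linkAdj? F v) a
  inComponent : Fin _ → ℤ
  inComponent x = 𝟙[ reach? x ]
  component-closed : ∀ {y z} → LinkAdj F v y z → inComponent y ≡ inComponent z
  component-closed {y} {z} yz =
    𝟙-cong (reach? y) (reach? z) (λ a⇝y → a⇝y ◅◅ return yz) (λ a⇝z → a⇝z ◅◅ return (LinkAdj-sym yz))
  ¬avoiding : ¬ ConnectedAvoiding F v a b
  ¬avoiding π = ¬prime[1] (subst Prime (∣1⇒≡1 1≡0) p-prime)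
    where
    1≡0 : (+ 1) ≡[mod p ] (+ 0)
    1≡0 = subst₂ _≡[mod p ]_ (𝟙-yes (reach? a) ε) (𝟙-no (reach? b) a⇸b)
            (link-invariant-mod va vb π wf H inComponent component-closed)

mainTheorem18 : (p : ℕ) → Prime p → (n : ℕ) → (F : List (Triangle n)) →
    WellFormed n F → H₁Vanishes p n F → (∀ v → ¬ IsCutVertex F v) →
    LocallyConnected F
mainTheorem18 p p-prime n F wf H ¬cut v = link-connected p-prime wf H v (¬cut v)
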